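{- For every $r\in\mathbb N$ and every graph $G$, $\mathrm{adm}_r(G)+1\le \mathrm{copw}_r(G)\le \mathrm{wcol}_{2r}(G)+1$.
   Context: Graphs are finite, undirected, without loops. The $r$-weak coloring number $\mathrm{wcol}_r(G)$ is the least $k$ such that there is a total order $<$ on $V(G)$ in which, for every vertex $v$, at most $k$ vertices $w<v$ are weakly $r$-reachable from $v$, i.e. there is a path of length at most $r$ from $v$ to $w$ in which $w$ is the $<$-smallest vertex. The $r$-admissibility $\mathrm{adm}_r(G)$ is the least $k$ such that there is a total order $<$ on $V(G)$ such that for every $v$ one cannot find more than $k$ paths of length at most $r$, each starting at $v$ and ending at some vertex $w<v$, pairwise sharing only $v$. Cops and Robber game of radius $r$ and width $k$ on $G$: there are $k$ cops, each either on a vertex or in a helicopter, and a robber on a vertex. Initially all cops are in helicopters and the robber chooses a starting vertex. In each round the cops announce a set $X$ of at most $k$ vertices on which they will land; before they land, the robber, knowing $X$, may move along a path of length at most $r$ (possibly $0$) passing through no vertex occupied by a cop that remains on the ground (occupied both before and after the move); then the cops land on $X$. The cops win if a cop lands on the robber's vertex. $\mathrm{copw}_r(G)$ is the least $k$ such that the cops have a winning strategy. -}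

module Defs where

open import Data.Nat using (ℕ; suc; _+_; _≤_)
open import Data.Bool using (Bool; true; false)
open import Data.Fin as F using (Fin)
open import Data.Fin.Subset as S using (Subset; ∣_∣)
open import Data.List using (List; []; _∷_; _∷ʳ_; length)
open import Data.List.Relation.Unary.All using (All)
open import Data.List.Relation.Unary.Linked using (Linked)
open import Data.List.Relation.Unary.Unique.Propositional using (Unique)
open import Data.List.Relation.Unary.AllPairs using (AllPairs)
open import Data.List.Membership.Propositional renaming (_∈_ to _∈L_)
open import Data.Product using (Σ; ∃; _×_; _,_; proj₁)
open import Data.Sum using (_⊎_)
open import Relation.Nullary using (¬_)
open import Relation.Binary.PropositionalEquality using (_≡_)
open import Function.Definitions using (Injective)

record Graph (n : ℕ) : Set where
  field
    adj        : Fin n → Fin n → Bool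
    adj-sym    : ∀ u v → adj u v ≡ adj v u
    adj-irrefl : ∀ v → adj v v ≡ false

module _ {n : ℕ} (G : Graph n) where
  open Graph G

  Edge : Fin n → Fin n → Set
  Edge u v = adj u v ≡ true

  -- ps is (the vertex sequence of) a path from v to w:
  -- starts at v, ends at w, consecutive vertices adjacent, vertices distinct.
  -- Its length (number of edges) is  length ps - 1.
  record IsPathFromTo (v w : Fin n) (ps : List (Fin n)) : Set where
    field
      start  : ∃ λ qs → ps ≡ v ∷ qs
      end    : ∃ λ qs → ps ≡ qs ∷ʳ w
      linked : Linked Edge ps
      unique : Unique ps

  ShortPath : ℕ → Fin n → Fin n → List (Fin n) → Set
  ShortPath r v w ps = IsPathFromTo v w ps × length ps ≤ suc r

  -- A total order on V(G) is given by an injective ranking π : Fin n → Fin n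
  -- (a bijection); w < v  iff  π w < π v.
  Order : Set
  Order = Σ (Fin n → Fin n) λ π → Injective _≡_ _≡_ π

  WReach : (Fin n → Fin n) → ℕ → Fin n → Fin n → Set
  WReach π r v w = ∃ λ ps → ShortPath r v w ps × All (λ x → π w F.≤ π x) ps

  -- wcol_r(G) ≤ k : some order in which every v has at most k vertices w < v
  -- that are weakly r-reachable from v (counted as: every duplicate-free list
  -- of such vertices has length ≤ k).
  WcolLE : ℕ → ℕ → Set
  WcolLE r k = ∃ λ (o : Order) → let π = proj₁ o in
    ∀ v (ws : List (Fin n)) → Unique ws →
      All (λ w → π w F.< π v × WReach π r v w) ws → length ws ≤ k

  AdmLE : ℕ → ℕ → Set
  AdmLE r k = ∃ λ (o : Order) → let π = proj₁ o in
    ∀ v (ps : List (List (Fin n))) →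
      All (λ p → ∃ λ w → π w F.< π v × ShortPath r v w p) ps →
      AllPairs (λ p q → ∀ x → x ∈L p → x ∈L q → x ≡ v) ps →
      length ps ≤ k

  -- CopsWinFrom r k C v : the cops currently on the ground occupy C, the robber
  -- is on v, and the cops (to announce next) can force a win in finitely many
  -- rounds. In a round the cops announce X with |X| ≤ k; the robber moves along
  -- a path of length ≤ r avoiding vertices in C ∩ X (cops staying on the
  -- ground); then the cops land on X and win if the robber is on a vertex of X.
  data CopsWinFrom (r k : ℕ) : Subset n → Fin n → Set where
    step : ∀ {C v} (X : Subset n) → ∣ X ∣ ≤ k →
      (∀ v' ps → ShortPath r v v' ps →
         All (λ x → ¬ (x S.∈ C × x S.∈ X)) ps →
         v' S.∈ X ⊎ CopsWinFrom r k X v') →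
      CopsWinFrom r k C v

  -- The cops have a winning strategy: whatever start vertex the robber picks
  -- (all cops initially in helicopters).
  CopsWin : ℕ → ℕ → Set
  CopsWin r k = ∀ v → CopsWinFrom r k S.⊥ v

Least : (ℕ → Set) → ℕ → Set
Least P m = P m × (∀ k → P k → m ≤ k)

module Submission where

-- Fix an order witnessing wcol_2r(G) ≤ w and let region v be the set of vertices
-- weakly 2r-reachable from v (at most w + 1 vertices, v included). The cops always land on the
-- region of the robber's current vertex. If the robber reached v from his previous vertex x along a
-- walk of length ≤ r through ranks ≥ θ, then his next run from v only visits ranks > θ: the first
-- vertex of rank ≤ θ on it would be weakly 2r-reachable from x and from v, hence guarded by a cop
-- who stays on the ground. So θ increases every round and the robber is caught within n rounds.
--
-- If k + 1 cops win, repeatedly delete from the remaining set A a vertex v without a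
-- fan of k + 1 paths of length ≤ r from v to A ∖ {v} meeting only at v, giving it the largest rank
-- among the remaining vertices; this yields an order witnessing adm_r(G) ≤ k. Such a v always exists:
-- otherwise the robber stays inside A forever, because whenever the cops announce his vertex, one of
-- the k + 1 paths of his fan misses the at most k other announced vertices and he escapes along it.

open import Defs
open import Data.Bool using (true)
import Data.Bool.Properties as Bool
open import Data.Empty using (⊥-elim)
open import Data.Fin as F using (Fin)
open import Data.Fin.Properties as FP using (_≟_; any?)
open import Data.Fin.Subset as S
  using (Subset; ∣_∣; inside; outside; _─_; _-_; ⁅_⁆)
open import Data.Fin.Subset.Properties
  using (_∈?_; ∈⊤; ∉⊥; ∣⊤∣≡n; ∣⊥∣≡0; ∣⁅x⁆∣≡1; x∈⁅x⁆; p─q⊆p; p⊆q⇒∣p∣≤∣q∣; x∈p∧x≢y⇒x∈p-y; x∈p⇒∣p-x∣<∣p∣)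
open import Data.List
  using (List; []; _∷_; _∷ʳ_; length; map; concat; concatMap; filter; allFin; drop; take; initLast; _∷ʳ′_)
open import Data.List.Properties using (∷ʳ-injectiveʳ; ∷-injectiveʳ; length-map; length-take)
open import Data.List.Membership.Propositional using (_∈_; _∉_; find)
open import Data.List.Membership.Propositional.Properties
  using (∉[]; ∈-++⁺ˡ; ∈-++⁺ʳ; ∈-map⁺; ∈-concat⁻′; ∈-concatMap⁺; ∈-filter⁺; ∈-allFin)
open import Data.List.Relation.Binary.Disjoint.Propositional using (Disjoint)
open import Data.List.Relation.Unary.All as All using (All; []; _∷_)
import Data.List.Relation.Unary.All.Properties as All
open import Data.List.Relation.Unary.AllPairs as AllPairs using (AllPairs; []; _∷_)
import Data.List.Relation.Unary.AllPairs.Properties as AllPairs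
open import Data.List.Relation.Unary.Any as Any using (Any)
open import Data.List.Relation.Unary.Linked as Linked using (Linked; [-]; _∷_)
open import Data.List.Relation.Unary.Unique.Propositional using (Unique)
import Data.List.Relation.Unary.Unique.Propositional.Properties as Unique
open import Data.Nat using (ℕ; zero; suc; _+_; _*_; _≤_; _<_; _≤?_; z≤n; s≤s)
open import Data.Nat.Properties as ℕ
  using ( ≤-refl; ≤-reflexive; ≤-trans; ≤-pred; m≤m+n; m≤n+m; m≤n⇒m≤1+n; +-monoʳ-≤
        ; +-identityʳ; +-suc; +-assoc; +-comm; ≤∧≢⇒<; <⇒≱; ≰⇒>; n≮0; 1+n≰n; m≤n⇒m⊓n≡m)
open import Data.Product using (∃; _×_; _,_; proj₁; proj₂)
open import Data.Sum using (inj₁; inj₂)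
open import Data.Vec using ([]; _∷_; here; there; tabulate)
open import Data.Vec.Properties using (lookup∘tabulate; []=⇒lookup; lookup⇒[]=)
open import Function using (_∘_)
open import Function.Definitions using (Injective)
open import Relation.Binary.PropositionalEquality using (_≡_; _≢_; refl; sym; trans; cong; subst; subst₂)
open import Relation.Nullary using (Dec; yes; no; does; ¬_; _×-dec_; _→-dec_; ¬?)
import Relation.Nullary.Decidable as Dec
open import Relation.Unary using (Decidable)

private variable
  n : ℕ

∣p∣≤∣p─q∣+∣q∣ : ∀ (p q : Subset n) → ∣ p ∣ ≤ ∣ p ─ q ∣ + ∣ q ∣
∣p∣≤∣p─q∣+∣q∣ []            []            = z≤n
∣p∣≤∣p─q∣+∣q∣ (outside ∷ p) (outside ∷ q) = ∣p∣≤∣p─q∣+∣q∣ p q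
∣p∣≤∣p─q∣+∣q∣ (inside  ∷ p) (outside ∷ q) = s≤s (∣p∣≤∣p─q∣+∣q∣ p q)
∣p∣≤∣p─q∣+∣q∣ (outside ∷ p) (inside  ∷ q) =
  ≤-trans (m≤n⇒m≤1+n (∣p∣≤∣p─q∣+∣q∣ p q)) (≤-reflexive (sym (+-suc _ _)))
∣p∣≤∣p─q∣+∣q∣ (inside  ∷ p) (inside  ∷ q) =
  ≤-trans (s≤s (∣p∣≤∣p─q∣+∣q∣ p q)) (≤-reflexive (sym (+-suc _ _)))

∣p∣≤1+∣p-x∣ : ∀ (p : Subset n) x → ∣ p ∣ ≤ suc ∣ p - x ∣
∣p∣≤1+∣p-x∣ p x = ≤-trans (∣p∣≤∣p─q∣+∣q∣ p ⁅ x ⁆)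
  (≤-reflexive (trans (cong (∣ p - x ∣ +_) (∣⁅x⁆∣≡1 x)) (+-comm _ 1)))

x∈p─q⇒x∉q : ∀ {p q : Subset n} {x} → x S.∈ p ─ q → ¬ x S.∈ q
x∈p─q⇒x∉q {p = _ ∷ _} {outside ∷ _} here       ()
x∈p─q⇒x∉q {p = _ ∷ _} {_       ∷ _} (there x∈) (there x∈q) = x∈p─q⇒x∉q x∈ x∈q

covered⇒∣p∣≤length : ∀ (p : Subset n) xs → (∀ {x} → x S.∈ p → x ∈ xs) → ∣ p ∣ ≤ length xs
covered⇒∣p∣≤length {n} p [] p⊆[] =
  ≤-trans (p⊆q⇒∣p∣≤∣q∣ {q = S.⊥} (⊥-elim ∘ ∉[] ∘ p⊆[])) (≤-reflexive (∣⊥∣≡0 n))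
covered⇒∣p∣≤length p (x ∷ xs) p⊆x∷xs =
  ≤-trans (∣p∣≤1+∣p-x∣ p x) (s≤s (covered⇒∣p∣≤length (p - x) xs p-x⊆xs))
  where
  p-x⊆xs : ∀ {y} → y S.∈ p - x → y ∈ xs
  p-x⊆xs y∈ with p⊆x∷xs (p─q⊆p p ⁅ x ⁆ y∈)
  ... | Any.here refl  = ⊥-elim (x∈p─q⇒x∉q y∈ (x∈⁅x⁆ x))
  ... | Any.there y∈xs = y∈xs

unique⇒length≤∣p∣ : ∀ (p : Subset n) {xs} → Unique xs → All (S._∈ p) xs → length xs ≤ ∣ p ∣
unique⇒length≤∣p∣ p []               []          = z≤n
unique⇒length≤∣p∣ p {x ∷ xs} (x∉xs ∷ xs-uniq) (x∈p ∷ xs⊆p) =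
  ≤-trans (s≤s (unique⇒length≤∣p∣ (p - x) xs-uniq (All.zipWith xs⊆p-x (x∉xs , xs⊆p)))) (x∈p⇒∣p-x∣<∣p∣ x∈p)
  where
  xs⊆p-x : ∀ {y} → x ≢ y × y S.∈ p → y S.∈ p - x
  xs⊆p-x (x≢y , y∈p) = x∈p∧x≢y⇒x∈p-y y∈p (x≢y ∘ sym)

module _ {P : Fin n → Set} (P? : Decidable P) where

  setOf : Subset n
  setOf = tabulate (does ∘ P?)

  ∈setOf⁺ : ∀ {x} → P x → x S.∈ setOf
  ∈setOf⁺ {x} px = lookup⇒[]= x setOf (trans (lookup∘tabulate (does ∘ P?) x) (Dec.dec-true (P? x) px))

  ∈setOf⁻ : ∀ {x} → x S.∈ setOf → P x
  ∈setOf⁻ {x} x∈ with P? x | trans (sym (lookup∘tabulate (does ∘ P?) x)) ([]=⇒lookup x∈)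
  ... | yes px | _ = px
  ... | no  _  | ()

module _ {A : Set} where

  listsUpTo : ℕ → List A → List (List A)
  listsUpTo zero    E = [] ∷ []
  listsUpTo (suc m) E = [] ∷ concatMap (λ x → map (x ∷_) (listsUpTo m E)) E

  ∈-listsUpTo : ∀ {E} m {xs} → length xs ≤ m → All (_∈ E) xs → xs ∈ listsUpTo m E
  ∈-listsUpTo zero    {[]}     _         _            = Any.here refl
  ∈-listsUpTo (suc m) {[]}     _         _            = Any.here refl
  ∈-listsUpTo (suc m) {x ∷ xs} (s≤s len) (x∈E ∷ xs⊆E) =
    Any.there (∈-concatMap⁺ (λ y → map (y ∷_) (listsUpTo m _))
                            (Any.map (λ { refl → ∈-map⁺ (x ∷_) (∈-listsUpTo m len xs⊆E) }) x∈E))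

  ∃-boundedList? : ∀ {P : List A → Set} E m → Decidable P →
                   (∀ {xs} → P xs → length xs ≤ m × All (_∈ E) xs) → Dec (∃ P)
  ∃-boundedList? E m P? bounded = Dec.map′ Any.satisfied
    (λ (xs , pxs) → let len , xs⊆E = bounded pxs in Any.map (λ { refl → pxs }) (∈-listsUpTo m len xs⊆E))
    (Any.any? P? (listsUpTo m E))

  ∈-drop1⇒∈ : ∀ {x : A} {xs} → x ∈ drop 1 xs → x ∈ xs
  ∈-drop1⇒∈ {xs = _ ∷ _} = Any.there

  private
    distinctWitnessesIn : ∀ {P : A → Set} {xss} → AllPairs Disjoint xss → All (Any P) xss →
      ∃ λ ys → length ys ≡ length xss × Unique ys × All (λ y → P y × y ∈ concat xss) ys
    distinctWitnessesIn []                  []          = [] , refl , [] , []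
    distinctWitnessesIn {xss = xs ∷ xss} (xs#xss ∷ disj) (pxs ∷ wit)
      with find pxs | distinctWitnessesIn disj wit
    ... | y , y∈xs , py | ys , len , uniq , pys =
      y ∷ ys , cong suc len , fresh ∷ uniq ,
      (py , ∈-++⁺ˡ y∈xs) ∷ All.map (λ (py' , y'∈) → py' , ∈-++⁺ʳ xs y'∈) pys
      where
      fresh : All (y ≢_) ys
      fresh = All.map (λ { (_ , y'∈) refl → let _ , y∈xs' , xs'∈xss = ∈-concat⁻′ xss y'∈
                                             in All.lookup xs#xss xs'∈xss (y∈xs , y∈xs') }) pys

  distinctWitnesses : ∀ {P : A → Set} {xss} → AllPairs Disjoint xss → All (Any P) xss →
                      ∃ λ ys → length ys ≡ length xss × Unique ys × All P ys
  distinctWitnesses disj wit =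
    let ys , len , uniq , pys = distinctWitnessesIn disj wit in ys , len , uniq , All.map proj₁ pys

startsWith? : ∀ v (ps : List (Fin n)) → Dec (∃ λ qs → ps ≡ v ∷ qs)
startsWith? v []       = no λ ()
startsWith? v (a ∷ qs) with a ≟ v
... | yes refl = yes (qs , refl)
... | no  a≢v  = no λ { (_ , refl) → a≢v refl }

endsWith? : ∀ w (ps : List (Fin n)) → Dec (∃ λ qs → ps ≡ qs ∷ʳ w)
endsWith? w ps with initLast ps
... | []       = no λ { ([] , ()) ; (_ ∷ _ , ()) }
... | qs ∷ʳ′ a with a ≟ w
...   | yes refl = yes (qs , refl)
...   | no  a≢w  = no λ (qs' , eq) → a≢w (∷ʳ-injectiveʳ qs qs' eq)

module _ {n : ℕ} (G : Graph n) where

  open import Data.List.Membership.DecPropositional (_≟_ {n}) using () renaming (_∈?_ to _∈L?_)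
  open import Data.List.Relation.Unary.Unique.DecPropositional (_≟_ {n}) using (unique?)

  Edge? : ∀ a b → Dec (Edge G a b)
  Edge? a b = Graph.adj G a b Bool.≟ true

  data SimplePath : Fin n → Fin n → List (Fin n) → Set where
    trivial : ∀ a → SimplePath a a (a ∷ [])
    prepend : ∀ {a b c ps} → Edge G a b → a ∉ ps → SimplePath b c ps → SimplePath a c (a ∷ ps)

  simplePath⇒isPath : ∀ {a c ps} → SimplePath a c ps → IsPathFromTo G a c ps
  simplePath⇒isPath p = record { start = starts p ; end = ends p ; linked = linked p ; unique = unique p }
    where
    starts : ∀ {a c ps} → SimplePath a c ps → ∃ λ qs → ps ≡ a ∷ qs
    starts (trivial a)     = [] , refl
    starts (prepend _ _ _) = _ , refl
    ends : ∀ {a c ps} → SimplePath a c ps → ∃ λ qs → ps ≡ qs ∷ʳ c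
    ends (trivial a)         = [] , refl
    ends (prepend {a} _ _ p) = let qs , eq = ends p in a ∷ qs , cong (a ∷_) eq
    linked : ∀ {a c ps} → SimplePath a c ps → Linked (Edge G) ps
    linked (trivial a)                     = [-]
    linked (prepend e _ (trivial _))       = e ∷ [-]
    linked (prepend e _ p@(prepend _ _ _)) = e ∷ linked p
    unique : ∀ {a c ps} → SimplePath a c ps → Unique ps
    unique (trivial a)                  = [] ∷ []
    unique (prepend {ps = ps} _ a∉ps p) = All.¬Any⇒All¬ ps a∉ps ∷ unique p

  suffixFrom : ∀ {P : Fin n → Set} {a c x ps} → SimplePath a c ps → x ∈ ps → All P ps →
               ∃ λ qs → SimplePath x c qs × length qs ≤ length ps × All P qs
  suffixFrom p@(trivial _)     (Any.here refl)  Pps       = _ , p , ≤-refl , Pps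
  suffixFrom p@(prepend _ _ _) (Any.here refl)  Pps       = _ , p , ≤-refl , Pps
  suffixFrom (prepend _ _ p)   (Any.there x∈ps) (_ ∷ Pps) =
    let qs , q , len , Pqs = suffixFrom p x∈ps Pps in qs , q , m≤n⇒m≤1+n len , Pqs

  -- Only the vertices before the last one are required to satisfy P. Thus walks concatenate freely,
  -- and a walk from v to w through ranks ≥ rank w is exactly a weak reachability witness.
  data Walk (P : Fin n → Set) : ℕ → Fin n → Fin n → Set where
    stop : ∀ {ℓ a} → Walk P ℓ a a
    step : ∀ {ℓ a b c} → P a → Edge G a b → Walk P ℓ b c → Walk P (suc ℓ) a c

  Walk-map : ∀ {P Q : Fin n → Set} {ℓ a c} → (∀ {x} → P x → Q x) → Walk P ℓ a c → Walk Q ℓ a c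
  Walk-map f stop          = stop
  Walk-map f (step pa e w) = step (f pa) e (Walk-map f w)

  Walk-mono : ∀ {P ℓ ℓ' a c} → ℓ ≤ ℓ' → Walk P ℓ a c → Walk P ℓ' a c
  Walk-mono _          stop          = stop
  Walk-mono (s≤s ℓ≤ℓ') (step pa e w) = step pa e (Walk-mono ℓ≤ℓ' w)

  _++ʷ_ : ∀ {P ℓ ℓ' a b c} → Walk P ℓ a b → Walk P ℓ' b c → Walk P (ℓ + ℓ') a c
  _++ʷ_ {ℓ = ℓ} stop w' = Walk-mono (m≤n+m _ ℓ) w'
  step pa e w ++ʷ w'    = step pa e (w ++ʷ w')

  walk⇒simplePath : ∀ {P ℓ a c} → Walk P ℓ a c → P c →
                    ∃ λ ps → SimplePath a c ps × length ps ≤ suc ℓ × All P ps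
  walk⇒simplePath stop pc = _ , trivial _ , s≤s z≤n , pc ∷ []
  walk⇒simplePath {a = a} (step pa e w) pc with walk⇒simplePath w pc
  ... | ps , p , len , Pps with a ∈L? ps
  ...   | yes a∈ps = let qs , q , len' , Pqs = suffixFrom p a∈ps Pps in
                     qs , q , m≤n⇒m≤1+n (≤-trans len' len) , Pqs
  ...   | no  a∉ps = a ∷ ps , prepend e a∉ps p , s≤s len , pa ∷ Pps

  walk⇒shortPath : ∀ {P ℓ a c} → Walk P ℓ a c → P c → ∃ λ ps → ShortPath G ℓ a c ps × All P ps
  walk⇒shortPath w pc =
    let ps , p , len , Pps = walk⇒simplePath w pc in ps , (simplePath⇒isPath p , len) , Pps

  shortPath⇒walk : ∀ {P ℓ a c ps} → ShortPath G ℓ a c ps → All P ps → Walk P ℓ a c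
  shortPath⇒walk {P} {c = c} (path , len) Pps with IsPathFromTo.start path
  ... | qs , refl =
    Walk-mono (≤-pred len) (linked⇒walk qs (IsPathFromTo.linked path) (IsPathFromTo.end path) Pps)
    where
    linked⇒walk : ∀ {a} qs → Linked (Edge G) (a ∷ qs) → (∃ λ zs → a ∷ qs ≡ zs ∷ʳ c) → All P (a ∷ qs) →
                  Walk P (length qs) a c
    linked⇒walk []       _        (zs , eq) _ rewrite ∷ʳ-injectiveʳ [] zs eq = stop
    linked⇒walk (b ∷ qs) (e ∷ lk) ([]     , ())
    linked⇒walk (b ∷ qs) (e ∷ lk) (z ∷ zs , eq) (pa ∷ Pqs) =
      step pa e (linked⇒walk qs lk (zs , ∷-injectiveʳ eq) Pqs)

  isPath? : ∀ v w ps → Dec (IsPathFromTo G v w ps)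
  isPath? v w ps = Dec.map′ (λ (s , e , l , u) → record { start = s ; end = e ; linked = l ; unique = u })
    (λ p → IsPathFromTo.start p , IsPathFromTo.end p , IsPathFromTo.linked p , IsPathFromTo.unique p)
    (startsWith? v ps ×-dec endsWith? w ps ×-dec Linked.linked? Edge? ps ×-dec unique? ps)

  shortPath? : ∀ r v w ps → Dec (ShortPath G r v w ps)
  shortPath? r v w ps = isPath? v w ps ×-dec length ps ≤? suc r

  end∈ : ∀ {v w ps} → IsPathFromTo G v w ps → w ∈ ps
  end∈ p with IsPathFromTo.end p
  ... | qs , refl = ∈-++⁺ʳ qs (Any.here refl)

  start∉rest : ∀ {v w ps} → IsPathFromTo G v w ps → v ∉ drop 1 ps
  start∉rest p with IsPathFromTo.start p | IsPathFromTo.unique p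
  ... | qs , refl | v∉qs ∷ _ = All.All¬⇒¬Any v∉qs

  end∈rest : ∀ {v w ps} → IsPathFromTo G v w ps → w ≢ v → w ∈ drop 1 ps
  end∈rest p w≢v with IsPathFromTo.start p | end∈ p
  ... | qs , refl | Any.here w≡v   = ⊥-elim (w≢v w≡v)
  ... | qs , refl | Any.there w∈qs = w∈qs

  stay : ∀ r v → ShortPath G r v v (v ∷ [])
  stay r v = simplePath⇒isPath (trivial v) , s≤s z≤n

  module CopsStrategy (π : Fin n → Fin n) (π-inj : Injective _≡_ _≡_ π) (r k : ℕ)
    (wcol : ∀ v ws → Unique ws → All (λ w → π w F.< π v × WReach G π (2 * r) v w) ws → length ws ≤ k)
    where

    ρ : Fin n → ℕ
    ρ v = F.toℕ (π v)

    Above : ℕ → Fin n → Set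
    Above θ x = θ ≤ ρ x

    reach? : ∀ v w → Dec (WReach G π (2 * r) v w)
    reach? v w = ∃-boundedList? (allFin n) (suc (2 * r))
      (λ ps → shortPath? (2 * r) v w ps ×-dec All.all? (λ x → ρ w ≤? ρ x) ps)
      (λ ((_ , len) , _) → len , All.tabulate (λ {x} _ → ∈-allFin x))

    region : Fin n → Subset n
    region v = setOf (reach? v)

    reach⇒≤ : ∀ {v w} → WReach G π (2 * r) v w → ρ w ≤ ρ v
    reach⇒≤ (_ , (path , _) , _) with IsPathFromTo.start path
    reach⇒≤ (_ , _ , ρw≤ρv ∷ _) | _ , refl = ρw≤ρv

    ∣region∣≤1+k : ∀ v → ∣ region v ∣ ≤ suc k
    ∣region∣≤1+k v =
      ≤-trans (covered⇒∣p∣≤length (region v) (v ∷ ws) region⊆v∷ws) (s≤s (wcol v ws ws-unique ws-below))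
      where
      Other? : ∀ w → Dec (w S.∈ region v × w ≢ v)
      Other? w = w ∈? region v ×-dec ¬? (w ≟ v)
      ws : List (Fin n)
      ws = filter Other? (allFin n)
      ws-unique : Unique ws
      ws-unique = Unique.filter⁺ Other? (Unique.allFin⁺ n)
      ws-below : All (λ w → π w F.< π v × WReach G π (2 * r) v w) ws
      ws-below = All.map (λ (w∈ , w≢v) → let reach = ∈setOf⁻ (reach? v) w∈ in
                            ≤∧≢⇒< (reach⇒≤ reach) (w≢v ∘ π-inj ∘ FP.toℕ-injective) , reach)
                         (All.all-filter Other? (allFin n))
      region⊆v∷ws : ∀ {w} → w S.∈ region v → w ∈ v ∷ ws
      region⊆v∷ws {w} w∈ with w ≟ v
      ... | yes refl = Any.here refl
      ... | no  w≢v  = Any.there (∈-filter⁺ Other? (∈-allFin w) (w∈ , w≢v))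

    walk∈region : ∀ {ℓ v w} → ℓ ≤ 2 * r → Walk (Above (ρ w)) ℓ v w → w S.∈ region v
    walk∈region ℓ≤2r walk = ∈setOf⁺ (reach? _) (walk⇒shortPath (Walk-mono ℓ≤2r walk) ≤-refl)

    climb : ∀ {C x v θ} → (∀ {y} → y S.∈ region x → y S.∈ C) → Walk (Above θ) r x v →
            ∀ {v' ps} → ShortPath G r v v' ps → All (λ y → ¬ (y S.∈ C × y S.∈ region v)) ps →
            All (Above (suc θ)) ps
    climb {C} {x} {v} {θ} region⊆C x↝v (path , len) free with IsPathFromTo.start path
    ... | qs , refl = go 0 qs (≤-pred len) (IsPathFromTo.linked path) stop free
      where
      go : ∀ ℓ {a} qs → ℓ + length qs ≤ r → Linked (Edge G) (a ∷ qs) → Walk (Above (suc θ)) ℓ v a →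
           All (λ y → ¬ (y S.∈ C × y S.∈ region v)) (a ∷ qs) → All (Above (suc θ)) (a ∷ qs)
      go ℓ {a} qs len lk v↝a (a-free ∷ free) with suc θ ≤? ρ a
      go ℓ {a} qs len lk v↝a (a-free ∷ free) | no θ≮ρa = ⊥-elim (a-free (region⊆C a∈region-x , a∈region-v))
        where
        ρa≤θ : ρ a ≤ θ
        ρa≤θ = ≤-pred (≰⇒> θ≮ρa)
        ℓ≤r : ℓ ≤ r
        ℓ≤r = ≤-trans (m≤m+n ℓ _) len
        v↝a' : Walk (Above (ρ a)) ℓ v a
        v↝a' = Walk-map (≤-trans (m≤n⇒m≤1+n ρa≤θ)) v↝a
        a∈region-v : a S.∈ region v
        a∈region-v = walk∈region (≤-trans ℓ≤r (m≤m+n r _)) v↝a'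
        a∈region-x : a S.∈ region x
        a∈region-x = walk∈region (+-monoʳ-≤ r (≤-trans ℓ≤r (m≤m+n r 0)))
                                 (Walk-map (≤-trans ρa≤θ) x↝v ++ʷ v↝a')
      go ℓ []       len lk       v↝a (_ ∷ free) | yes θ<ρa = θ<ρa ∷ []
      go ℓ (b ∷ qs) len (e ∷ lk) v↝a (_ ∷ free) | yes θ<ρa =
        θ<ρa ∷ go (ℓ + 1) qs (subst (_≤ r) (sym (+-assoc ℓ 1 _)) len) lk (v↝a ++ʷ step θ<ρa e stop) free

    chase : ∀ fuel θ → n ≤ θ + fuel → ∀ {C x v} → (∀ {y} → y S.∈ region x → y S.∈ C) →
            Walk (Above θ) r x v → Above θ v → CopsWinFrom G r (suc k) C v
    chase zero θ n≤θ _ _ θ≤ρv =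
      ⊥-elim (<⇒≱ (FP.toℕ<n (π _)) (≤-trans n≤θ (≤-trans (≤-reflexive (+-identityʳ θ)) θ≤ρv)))
    chase (suc fuel) θ n≤θ+1+fuel region⊆C x↝v _ =
      CopsWinFrom.step (region _) (∣region∣≤1+k _) λ v' ps path free →
        let above = climb region⊆C x↝v path free in
        inj₂ (chase fuel (suc θ) (subst (n ≤_) (+-suc θ fuel) n≤θ+1+fuel) (λ y∈ → y∈)
                (shortPath⇒walk path above) (All.lookup above (end∈ (proj₁ path))))

    copsWin : CopsWin G r (suc k)
    copsWin v = CopsWinFrom.step (region v) (∣region∣≤1+k v) λ v' ps path _ →
      inj₂ (chase n 0 ≤-refl (λ y∈ → y∈) (shortPath⇒walk path (All.tabulate (λ _ → z≤n))) z≤n)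

  module RobberStrategy (r : ℕ) where

    SharingOnly : Fin n → List (Fin n) → List (Fin n) → Set
    SharingOnly v p q = ∀ x → x ∈ p → x ∈ q → x ≡ v

    Family : (Fin n → Set) → Fin n → List (List (Fin n)) → Set
    Family T v ps = All (λ p → ∃ λ w → T w × ShortPath G r v w p) ps × AllPairs (SharingOnly v) ps

    Other : Subset n → Fin n → Fin n → Set
    Other A v w = w S.∈ A × w ≢ v

    Fan : ℕ → Subset n → Fin n → Set
    Fan c A v = ∃ λ ps → length ps ≡ c × Family (Other A v) v ps

    restsDisjoint : ∀ {v ps} → All (λ p → v ∉ drop 1 p) ps → AllPairs (SharingOnly v) ps →
                    AllPairs Disjoint (map (drop 1) ps)
    restsDisjoint []             []          = []
    restsDisjoint {v} {p ∷ _} (v∉p ∷ v∉rest) (p-shares ∷ sharing) =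
      All.map⁺ (All.map rests-disjoint p-shares) ∷ restsDisjoint v∉rest sharing
      where
      rests-disjoint : ∀ {q} → SharingOnly v p q → Disjoint (drop 1 p) (drop 1 q)
      rests-disjoint p~q {x} (x∈p , x∈q) = v∉p (subst (_∈ _) (p~q x (∈-drop1⇒∈ x∈p) (∈-drop1⇒∈ x∈q)) x∈p)

    -- If every rest were blocked, v and one announced vertex on each rest would be c + 1 distinct
    -- vertices of X.
    clearRest : ∀ {c X v ps} → v S.∈ X → ∣ X ∣ ≤ c → length ps ≡ c →
                All (λ p → v ∉ drop 1 p) ps → AllPairs (SharingOnly v) ps →
                Any (λ p → All (λ y → ¬ y S.∈ X) (drop 1 p)) ps
    clearRest {c} {X} {v} {ps} v∈X ∣X∣≤c len v∉rests sharing =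
      Dec.decidable-stable (Any.any? (All.all? (λ y → ¬? (y ∈? X)) ∘ drop 1) ps) λ none →
        let ys , len-ys , ys-unique , ys⊆X = distinctWitnesses disjoint (witnesses none) in
        1+n≰n (begin
          suc c                          ≡⟨ cong suc (trans (sym len) (sym (length-map (drop 1) ps))) ⟩
          suc (length (map (drop 1) ps)) ≡⟨ sym len-ys ⟩
          length ys                      ≤⟨ unique⇒length≤∣p∣ X ys-unique ys⊆X ⟩
          ∣ X ∣                          ≤⟨ ∣X∣≤c ⟩
          c                              ∎)
      where
      open ℕ.≤-Reasoning
      rests : List (List (Fin n))
      rests = (v ∷ []) ∷ map (drop 1) ps
      disjoint : AllPairs Disjoint rests
      disjoint = All.map⁺ (All.map (λ { v∉rest (Any.here refl , v∈rest) → v∉rest v∈rest }) v∉rests)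
                 ∷ restsDisjoint v∉rests sharing
      witnesses : ¬ Any (λ p → All (λ y → ¬ y S.∈ X) (drop 1 p)) ps → All (Any (S._∈ X)) rests
      witnesses none = Any.here v∈X ∷ All.map⁺ (All.map
        (λ blocked → Any.map (Dec.decidable-stable (_ ∈? X)) (All.¬All⇒Any¬ (λ y → ¬? (y ∈? X)) _ blocked))
        (All.¬Any⇒All¬ ps none))

    runFree : ∀ {C X v w p} → IsPathFromTo G v w p → ¬ v S.∈ C → All (λ y → ¬ y S.∈ X) (drop 1 p) →
              All (λ y → ¬ (y S.∈ C × y S.∈ X)) p
    runFree path v∉C clear with IsPathFromTo.start path
    ... | _ , refl = (v∉C ∘ proj₁) ∷ All.map (_∘ proj₂) clear

    dodge : ∀ {c A} → (∀ {v} → v S.∈ A → Fan c A v) → ∀ {C X v} → v S.∈ A → ¬ v S.∈ C → ∣ X ∣ ≤ c →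
            ∃ λ w → ∃ λ p → w S.∈ A × ¬ w S.∈ X × ShortPath G r v w p × All (λ y → ¬ (y S.∈ C × y S.∈ X)) p
    dodge fans {X = X} {v} v∈A v∉C ∣X∣≤c with v ∈? X
    ... | no v∉X = v , v ∷ [] , v∈A , v∉X , stay r v , runFree (proj₁ (stay r v)) v∉C []
    ... | yes v∈X with fans v∈A
    ...   | ps , len , paths , sharing
            with find (clearRest v∈X ∣X∣≤c len (All.map (start∉rest ∘ proj₁ ∘ proj₂ ∘ proj₂) paths) sharing)
    ...     | p , p∈ps , clear with All.lookup paths p∈ps
    ...       | w , (w∈A , w≢v) , path =
                w , p , w∈A , All.lookup clear (end∈rest (proj₁ path) w≢v) , path ,
                runFree (proj₁ path) v∉C clear

    escape : ∀ {c A} → (∀ {v} → v S.∈ A → Fan c A v) →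
             ∀ {C v} → v S.∈ A → ¬ v S.∈ C → ¬ CopsWinFrom G r c C v
    escape fans v∈A v∉C (CopsWinFrom.step X ∣X∣≤c move) with dodge fans v∈A v∉C ∣X∣≤c
    ... | w , p , w∈A , w∉X , path , free with move w p path free
    ...   | inj₁ w∈X = w∉X w∈X
    ...   | inj₂ cw  = escape fans w∈A w∉X cw

    sharingOnly? : ∀ v p q → Dec (SharingOnly v p q)
    sharingOnly? v p q = Dec.map′ (λ all x x∈p → All.lookup all x∈p) (λ shares → All.tabulate (shares _))
      (All.all? (λ x → (x ∈L? q) →-dec (x ≟ v)) p)

    fan? : ∀ c A v → Dec (Fan c A v)
    fan? c A v = ∃-boundedList? (listsUpTo (suc r) (allFin n)) c
      (λ ps → (length ps ℕ.≟ c) ×-dec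
              All.all? (λ p → any? (λ w → (w ∈? A ×-dec ¬? (w ≟ v)) ×-dec shortPath? r v w p)) ps ×-dec
              AllPairs.allPairs? (sharingOnly? v) ps)
      (λ (len , paths , _) → ≤-reflexive len ,
         All.map (λ (_ , _ , _ , short) → ∈-listsUpTo (suc r) short (All.tabulate (λ {x} _ → ∈-allFin x)))
                 paths)

    module EliminationOrder (k : ℕ) (cops : CopsWin G r (suc k)) where

      Good : Subset n → Fin n → Set
      Good A v = ∀ ps → Family (Other A v) v ps → length ps ≤ k

      ¬fan⇒good : ∀ {A v} → ¬ Fan (suc k) A v → Good A v
      ¬fan⇒good ¬fan ps (paths , sharing) with length ps ≤? k
      ... | yes len≤k = len≤k
      ... | no  len≰k = ⊥-elim (¬fan (take (suc k) ps ,
            trans (length-take (suc k) ps) (m≤n⇒m⊓n≡m (≰⇒> len≰k)) ,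
            All.take⁺ (suc k) paths , AllPairs.take⁺ (suc k) sharing))

      record Elimination (A : Subset n) (s : ℕ) : Set where
        field
          rank     : Fin n → ℕ
          rank<    : ∀ {v} → v S.∈ A → rank v < s
          rank-inj : ∀ {u v} → u S.∈ A → v S.∈ A → rank u ≡ rank v → u ≡ v
          good     : ∀ {v} → v S.∈ A → ∃ λ B → Good B v × (∀ {w} → w S.∈ A → rank w < rank v → w S.∈ B)

      empty : ∀ {A s} → (∀ {v} → ¬ v S.∈ A) → Elimination A s
      empty ∉A = record
        { rank = λ _ → 0 ; rank< = ⊥-elim ∘ ∉A ; rank-inj = λ u∈A _ _ → ⊥-elim (∉A u∈A) ; good = ⊥-elim ∘ ∉A }

      extend : ∀ {A s v₀} → v₀ S.∈ A → Good A v₀ → Elimination (A - v₀) s → Elimination A (suc s)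
      extend {A} {s} {v₀} v₀∈A good₀ E =
        record { rank = rank ; rank< = rank< ; rank-inj = rank-inj ; good = good }
        where
        module E = Elimination E
        rank : Fin n → ℕ
        rank w with w ≟ v₀
        ... | yes _ = s
        ... | no  _ = E.rank w
        rank< : ∀ {v} → v S.∈ A → rank v < suc s
        rank< {v} v∈A with v ≟ v₀
        ... | yes _   = ≤-refl
        ... | no  v≢v₀ = ℕ.m<n⇒m<1+n (E.rank< (x∈p∧x≢y⇒x∈p-y v∈A v≢v₀))
        rank-inj : ∀ {u v} → u S.∈ A → v S.∈ A → rank u ≡ rank v → u ≡ v
        rank-inj {u} {v} u∈A v∈A eq with u ≟ v₀ | v ≟ v₀
        ... | yes refl | yes refl = refl
        ... | yes _    | no v≢v₀  = ⊥-elim (ℕ.<-irrefl (sym eq) (E.rank< (x∈p∧x≢y⇒x∈p-y v∈A v≢v₀)))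
        ... | no u≢v₀  | yes _    = ⊥-elim (ℕ.<-irrefl eq (E.rank< (x∈p∧x≢y⇒x∈p-y u∈A u≢v₀)))
        ... | no u≢v₀  | no v≢v₀  = E.rank-inj (x∈p∧x≢y⇒x∈p-y u∈A u≢v₀) (x∈p∧x≢y⇒x∈p-y v∈A v≢v₀) eq
        good : ∀ {v} → v S.∈ A → ∃ λ B → Good B v × (∀ {w} → w S.∈ A → rank w < rank v → w S.∈ B)
        good {v} v∈A with v ≟ v₀
        ... | yes refl = A , good₀ , λ w∈A _ → w∈A
        ... | no v≢v₀ with E.good (x∈p∧x≢y⇒x∈p-y v∈A v≢v₀)
        ...   | B , goodB , below⊆B = B , goodB , below
          where
          below : ∀ {w} → w S.∈ A → rank w < E.rank v → w S.∈ B
          below {w} w∈A rw<rv with w ≟ v₀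
          ... | yes _   = ⊥-elim (ℕ.<-asym rw<rv (E.rank< (x∈p∧x≢y⇒x∈p-y v∈A v≢v₀)))
          ... | no w≢v₀ = below⊆B (x∈p∧x≢y⇒x∈p-y w∈A w≢v₀) rw<rv

      eliminate : ∀ s {A} → ∣ A ∣ ≤ s → Elimination A s
      eliminate zero    ∣A∣≤0 = empty λ v∈A → ℕ.n≮0 (≤-trans (x∈p⇒∣p-x∣<∣p∣ v∈A) ∣A∣≤0)
      eliminate (suc s) {A} ∣A∣≤1+s with any? (λ v → v ∈? A ×-dec ¬? (fan? (suc k) A v))
      ... | yes (v , v∈A , ¬fan) =
            extend v∈A (¬fan⇒good ¬fan) (eliminate s (≤-pred (≤-trans (x∈p⇒∣p-x∣<∣p∣ v∈A) ∣A∣≤1+s)))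
      ... | no none = empty λ v∈A → escape fans v∈A ∉⊥ (cops _)
        where
        fans : ∀ {v} → v S.∈ A → Fan (suc k) A v
        fans {v} v∈A = Dec.decidable-stable (fan? (suc k) A v) λ ¬fan → none (v , v∈A , ¬fan)

      admissibility : AdmLE G r k
      admissibility = (π , π-inj) , bound
        where
        open Elimination (eliminate n {S.⊤} (≤-reflexive (∣⊤∣≡n n)))
        π : Fin n → Fin n
        π v = F.fromℕ< (rank< ∈⊤)
        toℕ-π : ∀ v → F.toℕ (π v) ≡ rank v
        toℕ-π v = FP.toℕ-fromℕ< (rank< ∈⊤)
        π-inj : ∀ {u v} → π u ≡ π v → u ≡ v
        π-inj {u} {v} eq = rank-inj ∈⊤ ∈⊤ (trans (sym (toℕ-π u)) (trans (cong F.toℕ eq) (toℕ-π v)))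
        bound : ∀ v ps → All (λ p → ∃ λ w → π w F.< π v × ShortPath G r v w p) ps →
                AllPairs (SharingOnly v) ps → length ps ≤ k
        bound v ps paths sharing with good {v} ∈⊤
        ... | B , goodB , below⊆B = goodB ps (All.map toOther paths , sharing)
          where
          toOther : ∀ {p} → (∃ λ w → π w F.< π v × ShortPath G r v w p) →
                    ∃ λ w → Other B v w × ShortPath G r v w p
          toOther (w , πw<πv , path) =
            w , (below⊆B ∈⊤ (subst₂ _<_ (toℕ-π w) (toℕ-π v) πw<πv) , λ { refl → ℕ.<-irrefl refl πw<πv }) ,
            path

    zeroCopsLose : Fin n → ¬ CopsWin G r 0
    zeroCopsLose v cops = escape (λ _ → [] , refl , [] , []) ∈⊤ ∉⊥ (cops v)

mainTheorem4 : (r n : ℕ) → 1 ≤ n → (G : Graph n) → (a c w : ℕ) →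
    Least (AdmLE G r) a → Least (CopsWin G r) c → Least (WcolLE G (2 * r)) w →
    a + 1 ≤ c × c ≤ w + 1
mainTheorem4 r (suc n) _ G a c w (_ , a-least) (cops-c , c-least) (((π , π-inj) , wcol) , _) =
  lower c cops-c , upper
  where
  open RobberStrategy G r
  upper : c ≤ w + 1
  upper = subst (c ≤_) (+-comm 1 w) (c-least (suc w) (CopsStrategy.copsWin G π π-inj r w wcol))
  lower : ∀ c → CopsWin G r c → a + 1 ≤ c
  lower zero    cops = ⊥-elim (zeroCopsLose F.zero cops)
  lower (suc k) cops =
    subst (_≤ suc k) (+-comm 1 a) (s≤s (a-least k (EliminationOrder.admissibility k cops)))
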